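{- Let $k\ge 2$, $x\ge 1$, $n=k+x$, with $(x,n)\notin\{(1,4),(1,6)\}$, and let $p$ be a positive integer with $p\leq \lambda^k(\overrightarrow{C_n})$. Then there exist positive integers $n_1,\dots,n_p$ with $n_1+\dots+n_p=n$ such that $$\sum_{i=1}^{p}\left\lfloor \frac{n_i(n_i-1)}{k}\right\rfloor+\sum_{i=1}^{p}\sum_{j=i+1}^{p}\left\lfloor \frac{2n_in_j}{k}\right\rfloor\geq n.$$
   Context: $\overrightarrow{C_n}$ is the directed cycle (circuit) on $n$ vertices and $\overleftrightarrow{K_n}$ the complete digraph on $n$ vertices. A $p$-labeled packing of $k$ copies of $\overrightarrow{C_n}$ is a map $f$ from $V(\overleftrightarrow{K_n})$ onto a set of exactly $p$ labels together with injections $\sigma_1,\dots,\sigma_k:V(\overrightarrow{C_n})\to V(\overleftrightarrow{K_n})$ such that for $i\neq j$ the induced arc images are disjoint, and for every vertex $v$, $f(\sigma_1(v))=\dots=f(\sigma_k(v))$. $\lambda^k(\overrightarrow{C_n})$ is the largest $p$ for which such a packing exists. -}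

module Defs where

open import Data.Nat using (ℕ; zero; suc; _+_; _*_; _∸_; _≤_; _<_)
open import Data.Nat.DivMod using (_/_; _%_; m%n<n)
open import Data.Fin using (Fin; toℕ; fromℕ<)
open import Data.List using (List; map; filter)
open import Data.Nat.ListAction using (sum)
open import Data.List.Base using (allFin)
open import Data.Product using (Σ; ∃; _×_; _,_)
open import Relation.Binary.PropositionalEquality using (_≡_; _≢_)
open import Relation.Nullary using (¬_)
open import Data.Nat.Properties using (_<?_)

-- cyclic successor on Fin n : v ↦ v+1 mod n  (arcs of the circuit C_n are v → next v)
next : ∀ {n} → Fin n → Fin n
next {suc m} i = fromℕ< (m%n<n (suc (toℕ i)) (suc m))

InjectiveMap : ∀ {n} → (Fin n → Fin n) → Set
InjectiveMap σ = ∀ u v → σ u ≡ σ v → u ≡ v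

-- A p-labeled packing of k copies of C_n into the complete digraph K_n
-- (both vertex sets are Fin n).
record LabeledPacking (n k p : ℕ) : Set where
  field
    f      : Fin n → Fin p
    f-onto : ∀ (y : Fin p) → ∃ λ v → f v ≡ y
    σ      : Fin k → Fin n → Fin n
    σ-inj  : ∀ i → InjectiveMap (σ i)
    arcs-disjoint : ∀ i j → i ≢ j → ∀ v w →
                    ¬ ((σ i v ≡ σ j w) × (σ i (next v) ≡ σ j (next w)))
    label-compat : ∀ i j v → f (σ i v) ≡ f (σ j v)

-- "p ≤ λ^k(C_n)": since λ^k(C_n) is the largest q admitting a q-labeled
-- packing, p ≤ λ^k(C_n) iff some q ≥ p admits a q-labeled packing.
LeLambda : (p k n : ℕ) → Set
LeLambda p k n = Σ ℕ λ q → (p ≤ q) × LabeledPacking n k q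

-- floor division (divisor will be k ≥ 2; value for divisor 0 is irrelevant)
fdiv : ℕ → ℕ → ℕ
fdiv a zero = 0
fdiv a (suc m) = a / suc m

sumFin : ∀ {p} → (Fin p → ℕ) → ℕ
sumFin {p} g = sum (map g (allFin p))

sumPairs : ∀ {p} → (Fin p → Fin p → ℕ) → ℕ
sumPairs {p} h = sumFin λ i → sum (map (h i) (filter (λ j → toℕ i <? toℕ j) (allFin p)))

-- Reducing labels mod p turns a packing with q ≥ p labels into one with exactly p labels;
-- let n_a be the size of label class a. Label compatibility gives every vertex of the
-- circuit a label, so its n arcs are split by label pair (a, b) into c_ab arcs. The k copies
-- send these to k·c_ab distinct arcs of K_n from class a to class b (disjointness of the arc
-- images), of which there are n_a·n_b for a ≠ b and n_a(n_a − 1) for a = b. Hence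
-- c_aa ≤ ⌊n_a(n_a − 1)/k⌋ and c_ab + c_ba ≤ ⌊2 n_a n_b / k⌋, and summing over all label
-- pairs bounds n = Σ c_ab.
module Submission where

open import Defs
open import Data.Nat using (ℕ; _+_; _*_; _∸_; _≤_; _<_; _≥_)
open import Data.Fin using (Fin)
open import Data.Product using (Σ; _×_; _,_)
open import Relation.Binary.PropositionalEquality using (_≡_)
open import Relation.Nullary using (¬_)

open import Data.Bool using (if_then_else_)
open import Data.Nat using (zero; suc; z≤n; s≤s; s≤s⁻¹; NonZero; _/_; _%_)
open import Data.Nat.Properties hiding (_≟_; suc-injective; 0≢1+n)
open import Data.Nat.DivMod using (_mod_; m%n<n; m≤n⇒m%n≡m; n%n≡0; m<n⇒m%n≡m; m*n/n≡m; /-monoˡ-≤)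
open import Data.Nat.Tactic.RingSolver using (solve-∀)
import Data.Nat.ListAction as List
open import Data.Fin using (zero; suc; toℕ; inject≤)
open import Data.Fin.Properties using (_≟_; suc-injective; 0≢1+n; toℕ-injective; toℕ-fromℕ<; toℕ-inject≤; toℕ<n)
open import Data.List using ([]; _∷_; map; filter; tabulate; allFin)
open import Data.Product using (∃; proj₁; proj₂)
open import Data.Sum using (inj₁; inj₂)
open import Function using (_∘_)
open import Relation.Binary.Definitions using (tri<; tri≈; tri>)
open import Relation.Binary.PropositionalEquality using (_≢_; refl; sym; trans; cong; cong₂; subst; module ≡-Reasoning)
open import Relation.Nullary using (Dec; yes; no; does; contradiction)
open import Relation.Nullary.Decidable using (¬?; _×-dec_; dec-true; dec-false)
open import Relation.Unary using (Pred; Decidable)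
open import Level using (0ℓ)
open import Algebra.Properties.CommutativeMonoid.Sum +-0-commutativeMonoid
  using (sum; sum-syntax; sum-cong-≗; sum-replicate-zero; ∑-comm; ∑-distrib-+)
open import Algebra.Properties.Semiring.Sum +-*-semiring using (*-distribˡ-sum; *-distribʳ-sum)

𝟙[_] : ∀ {a} {A : Set a} → Dec A → ℕ
𝟙[ d ] = if does d then 1 else 0

module _ {a} {A : Set a} where

  𝟙-yes : (d : Dec A) → A → 𝟙[ d ] ≡ 1
  𝟙-yes d x = cong (λ b → if b then 1 else 0) (dec-true d x)

  𝟙-no : (d : Dec A) → ¬ A → 𝟙[ d ] ≡ 0
  𝟙-no d ¬x = cong (λ b → if b then 1 else 0) (dec-false d ¬x)

  𝟙≤1 : (d : Dec A) → 𝟙[ d ] ≤ 1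
  𝟙≤1 (yes _) = ≤-refl
  𝟙≤1 (no _) = z≤n

  𝟙>0⇒ : (d : Dec A) → 0 < 𝟙[ d ] → A
  𝟙>0⇒ (yes x) _ = x

  𝟙-idem : (d : Dec A) → 𝟙[ d ] * 𝟙[ d ] ≡ 𝟙[ d ]
  𝟙-idem (yes _) = refl
  𝟙-idem (no _) = refl

  𝟙-split : (d : Dec A) (x : ℕ) → x ≡ 𝟙[ d ] * x + 𝟙[ ¬? d ] * x
  𝟙-split (yes _) x = sym (trans (+-identityʳ (x + 0)) (+-identityʳ x))
  𝟙-split (no _) x = sym (+-identityʳ x)

𝟙-×-dec : ∀ {a b} {A : Set a} {B : Set b} (d : Dec A) (e : Dec B) → 𝟙[ d ×-dec e ] ≡ 𝟙[ d ] * 𝟙[ e ]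
𝟙-×-dec (yes _) (yes _) = refl
𝟙-×-dec (yes _) (no _) = refl
𝟙-×-dec (no _) _ = refl

𝟙-≢ : ∀ {n} (a b : Fin n) → 𝟙[ ¬? (a ≟ b) ] ≡ 𝟙[ toℕ a <? toℕ b ] + 𝟙[ toℕ b <? toℕ a ]
𝟙-≢ a b with <-cmp (toℕ a) (toℕ b)
... | tri< a<b _ b≮a = trans (𝟙-yes (¬? (a ≟ b)) (λ a≡b → <-irrefl (cong toℕ a≡b) a<b))
                             (sym (cong₂ _+_ (𝟙-yes (_ <? _) a<b) (𝟙-no (_ <? _) b≮a)))
... | tri≈ a≮b a≡b b≮a = trans (𝟙-no (¬? (a ≟ b)) (λ a≢b → a≢b (toℕ-injective a≡b)))
                               (sym (cong₂ _+_ (𝟙-no (_ <? _) a≮b) (𝟙-no (_ <? _) b≮a)))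
... | tri> a≮b _ b<a = trans (𝟙-yes (¬? (a ≟ b)) (λ a≡b → <-irrefl (cong toℕ (sym a≡b)) b<a))
                             (sym (cong₂ _+_ (𝟙-no (_ <? _) a≮b) (𝟙-yes (_ <? _) b<a)))

∑-mono-≤ : ∀ {n} {f g : Fin n → ℕ} → (∀ i → f i ≤ g i) → sum f ≤ sum g
∑-mono-≤ {zero} _ = z≤n
∑-mono-≤ {suc n} f≤g = +-mono-≤ (f≤g zero) (∑-mono-≤ (f≤g ∘ suc))

≤-∑ : ∀ {n} (f : Fin n → ℕ) i → f i ≤ sum f
≤-∑ f zero = m≤m+n _ _
≤-∑ f (suc i) = ≤-trans (≤-∑ (f ∘ suc) i) (m≤n+m _ _)

∑-const : ∀ n x → ∑[ i < n ] x ≡ n * x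
∑-const zero x = refl
∑-const (suc n) x = cong (x +_) (∑-const n x)

∑-zero : ∀ {n} {f : Fin n → ℕ} → (∀ i → f i ≡ 0) → sum f ≡ 0
∑-zero {n} f≡0 = trans (sum-cong-≗ f≡0) (sum-replicate-zero n)

∑-pos⇒∃ : ∀ {n} (f : Fin n → ℕ) → 0 < sum f → ∃ λ i → 0 < f i
∑-pos⇒∃ {suc n} f pos with f zero in eq
... | zero = let i , fi>0 = ∑-pos⇒∃ (f ∘ suc) pos in suc i , fi>0
... | suc _ = zero , subst (0 <_) (sym eq) (s≤s z≤n)

∑-𝟙-≟ : ∀ {n} (x : Fin n) (g : Fin n → ℕ) → ∑[ a < n ] (𝟙[ x ≟ a ] * g a) ≡ g x
∑-𝟙-≟ {suc n} zero g = begin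
  (g zero + 0) + ∑[ a < n ] 0  ≡⟨ cong₂ _+_ (+-identityʳ (g zero)) (sum-replicate-zero n) ⟩
  g zero + 0                   ≡⟨ +-identityʳ (g zero) ⟩
  g zero                       ∎
  where open ≡-Reasoning
∑-𝟙-≟ {suc n} (suc x) g = ∑-𝟙-≟ x (g ∘ suc)

∑-𝟙 : ∀ {n} (x : Fin n) → ∑[ a < n ] 𝟙[ x ≟ a ] ≡ 1
∑-𝟙 x = trans (sum-cong-≗ (λ a → sym (*-identityʳ 𝟙[ x ≟ a ]))) (∑-𝟙-≟ x (λ _ → 1))

∑-unique-≤1 : ∀ {n} (f : Fin n → ℕ) → (∀ i → f i ≤ 1) →
              (∀ i j → 0 < f i → 0 < f j → i ≡ j) → sum f ≤ 1
∑-unique-≤1 {zero} f _ _ = z≤n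
∑-unique-≤1 {suc n} f f≤1 unique with f zero in eq | f≤1 zero
... | zero | _ = ∑-unique-≤1 (f ∘ suc) (f≤1 ∘ suc)
                   (λ i j fi>0 fj>0 → suc-injective (unique (suc i) (suc j) fi>0 fj>0))
... | suc (suc _) | s≤s ()
... | suc zero | _ = ≤-reflexive (cong suc (∑-zero rest≡0))
  where
  rest≡0 : ∀ i → f (suc i) ≡ 0
  rest≡0 i = n≤0⇒n≡0 (≮⇒≥ λ fi>0 → 0≢1+n (unique zero (suc i) (subst (0 <_) (sym eq) (s≤s z≤n)) fi>0))

∑∑-unique-≤1 : ∀ {m l} (f : Fin m → Fin l → ℕ) → (∀ i v → f i v ≤ 1) →
               (∀ i v j w → 0 < f i v → 0 < f j w → (i , v) ≡ (j , w)) →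
               ∑[ i < m ] ∑[ v < l ] f i v ≤ 1
∑∑-unique-≤1 f f≤1 unique = ∑-unique-≤1 (λ i → sum (f i)) rows≤1 rows-unique
  where
  rows≤1 : ∀ i → sum (f i) ≤ 1
  rows≤1 i = ∑-unique-≤1 (f i) (f≤1 i) (λ v w fv>0 fw>0 → cong proj₂ (unique i v i w fv>0 fw>0))
  rows-unique : ∀ i j → 0 < sum (f i) → 0 < sum (f j) → i ≡ j
  rows-unique i j fi>0 fj>0 =
    let v , fiv>0 = ∑-pos⇒∃ (f i) fi>0 ; w , fjw>0 = ∑-pos⇒∃ (f j) fj>0
    in cong proj₁ (unique i v j w fiv>0 fjw>0)

module _ {m l : ℕ} where

  ∑∑-cong : {f g : Fin m → Fin l → ℕ} → (∀ i v → f i v ≡ g i v) →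
            ∑[ i < m ] ∑[ v < l ] f i v ≡ ∑[ i < m ] ∑[ v < l ] g i v
  ∑∑-cong f≡g = sum-cong-≗ (λ i → sum-cong-≗ (f≡g i))

  ∑∑-mono-≤ : {f g : Fin m → Fin l → ℕ} → (∀ i v → f i v ≤ g i v) →
              ∑[ i < m ] ∑[ v < l ] f i v ≤ ∑[ i < m ] ∑[ v < l ] g i v
  ∑∑-mono-≤ f≤g = ∑-mono-≤ (λ i → ∑-mono-≤ (f≤g i))

  ∑∑-distrib-+ : (f g : Fin m → Fin l → ℕ) →
                 ∑[ i < m ] ∑[ v < l ] (f i v + g i v) ≡
                 ∑[ i < m ] ∑[ v < l ] f i v + ∑[ i < m ] ∑[ v < l ] g i v
  ∑∑-distrib-+ f g = trans (sum-cong-≗ (λ i → ∑-distrib-+ (f i) (g i)))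
                           (∑-distrib-+ (λ i → sum (f i)) (λ i → sum (g i)))

  ∑∑-distribʳ-* : (f : Fin m → Fin l → ℕ) (x : ℕ) →
                  (∑[ i < m ] ∑[ v < l ] f i v) * x ≡ ∑[ i < m ] ∑[ v < l ] (f i v * x)
  ∑∑-distribʳ-* f x = trans (*-distribʳ-sum x (λ i → sum (f i)))
                            (sum-cong-≗ (λ i → *-distribʳ-sum x (f i)))

∑∑-∑∑-comm : ∀ {m l n₁ n₂} (f : Fin m → Fin l → Fin n₁ → Fin n₂ → ℕ) →
             ∑[ i < m ] ∑[ v < l ] ∑[ u < n₁ ] ∑[ w < n₂ ] f i v u w ≡
             ∑[ u < n₁ ] ∑[ w < n₂ ] ∑[ i < m ] ∑[ v < l ] f i v u w
∑∑-∑∑-comm {m} {l} {n₁} {n₂} f = begin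
  ∑[ i < m ] ∑[ v < l ] ∑[ u < n₁ ] ∑[ w < n₂ ] f i v u w
    ≡⟨ sum-cong-≗ (λ i → ∑-comm (λ v u → ∑[ w < n₂ ] f i v u w)) ⟩
  ∑[ i < m ] ∑[ u < n₁ ] ∑[ v < l ] ∑[ w < n₂ ] f i v u w
    ≡⟨ ∑-comm (λ i u → ∑[ v < l ] ∑[ w < n₂ ] f i v u w) ⟩
  ∑[ u < n₁ ] ∑[ i < m ] ∑[ v < l ] ∑[ w < n₂ ] f i v u w
    ≡⟨ ∑∑-cong (λ u i → ∑-comm (λ v w → f i v u w)) ⟩
  ∑[ u < n₁ ] ∑[ i < m ] ∑[ w < n₂ ] ∑[ v < l ] f i v u w
    ≡⟨ sum-cong-≗ (λ u → ∑-comm (λ i w → ∑[ v < l ] f i v u w)) ⟩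
  ∑[ u < n₁ ] ∑[ w < n₂ ] ∑[ i < m ] ∑[ v < l ] f i v u w ∎
  where open ≡-Reasoning

∑∑-diagonal : ∀ {n} (X : Fin n → Fin n → ℕ) →
              ∑[ u < n ] ∑[ w < n ] X u w ≡
              ∑[ u < n ] X u u + ∑[ u < n ] ∑[ w < n ] (𝟙[ ¬? (u ≟ w) ] * X u w)
∑∑-diagonal {n} X = trans (sum-cong-≗ row)
  (∑-distrib-+ (λ u → X u u) (λ u → ∑[ w < n ] (𝟙[ ¬? (u ≟ w) ] * X u w)))
  where
  open ≡-Reasoning
  row : ∀ u → ∑[ w < n ] X u w ≡ X u u + ∑[ w < n ] (𝟙[ ¬? (u ≟ w) ] * X u w)
  row u = begin
    ∑[ w < n ] X u w
      ≡⟨ sum-cong-≗ (λ w → 𝟙-split (u ≟ w) (X u w)) ⟩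
    ∑[ w < n ] (𝟙[ u ≟ w ] * X u w + 𝟙[ ¬? (u ≟ w) ] * X u w)
      ≡⟨ ∑-distrib-+ (λ w → 𝟙[ u ≟ w ] * X u w) (λ w → 𝟙[ ¬? (u ≟ w) ] * X u w) ⟩
    ∑[ w < n ] (𝟙[ u ≟ w ] * X u w) + ∑[ w < n ] (𝟙[ ¬? (u ≟ w) ] * X u w)
      ≡⟨ cong (_+ ∑[ w < n ] (𝟙[ ¬? (u ≟ w) ] * X u w)) (∑-𝟙-≟ u (X u)) ⟩
    X u u + ∑[ w < n ] (𝟙[ ¬? (u ≟ w) ] * X u w) ∎

∑∑-upper : ∀ {n} (X : Fin n → Fin n → ℕ) →
           ∑[ u < n ] ∑[ w < n ] X u w ≡
           ∑[ u < n ] X u u + ∑[ u < n ] ∑[ w < n ] (𝟙[ toℕ u <? toℕ w ] * (X u w + X w u))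
∑∑-upper {n} X = trans (∑∑-diagonal X) (cong (∑[ u < n ] X u u +_) offDiagonal)
  where
  open ≡-Reasoning
  lt : Fin n → Fin n → ℕ
  lt u w = 𝟙[ toℕ u <? toℕ w ]
  offDiagonal : ∑[ u < n ] ∑[ w < n ] (𝟙[ ¬? (u ≟ w) ] * X u w) ≡
                ∑[ u < n ] ∑[ w < n ] (lt u w * (X u w + X w u))
  offDiagonal = begin
    ∑[ u < n ] ∑[ w < n ] (𝟙[ ¬? (u ≟ w) ] * X u w)
      ≡⟨ ∑∑-cong (λ u w → trans (cong (_* X u w) (𝟙-≢ u w)) (*-distribʳ-+ (X u w) (lt u w) (lt w u))) ⟩
    ∑[ u < n ] ∑[ w < n ] (lt u w * X u w + lt w u * X u w)
      ≡⟨ ∑∑-distrib-+ (λ u w → lt u w * X u w) (λ u w → lt w u * X u w) ⟩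
    ∑[ u < n ] ∑[ w < n ] (lt u w * X u w) + ∑[ u < n ] ∑[ w < n ] (lt w u * X u w)
      ≡⟨ cong (∑[ u < n ] ∑[ w < n ] (lt u w * X u w) +_) (∑-comm (λ u w → lt w u * X u w)) ⟩
    ∑[ u < n ] ∑[ w < n ] (lt u w * X u w) + ∑[ u < n ] ∑[ w < n ] (lt u w * X w u)
      ≡⟨ ∑∑-distrib-+ (λ u w → lt u w * X u w) (λ u w → lt u w * X w u) ⟨
    ∑[ u < n ] ∑[ w < n ] (lt u w * X u w + lt u w * X w u)
      ≡⟨ ∑∑-cong (λ u w → *-distribˡ-+ (lt u w) (X u w) (X w u)) ⟨
    ∑[ u < n ] ∑[ w < n ] (lt u w * (X u w + X w u)) ∎

∑∑-injective-≤ : ∀ {m l n₁ n₂} (g₁ : Fin m → Fin l → Fin n₁) (g₂ : Fin m → Fin l → Fin n₂) →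
                 (∀ i v j w → g₁ i v ≡ g₁ j w → g₂ i v ≡ g₂ j w → (i , v) ≡ (j , w)) →
                 (Q : Fin n₁ → Fin n₂ → ℕ) →
                 ∑[ i < m ] ∑[ v < l ] Q (g₁ i v) (g₂ i v) ≤ ∑[ u < n₁ ] ∑[ w < n₂ ] Q u w
∑∑-injective-≤ {m} {l} {n₁} {n₂} g₁ g₂ injective Q = begin
  ∑[ i < m ] ∑[ v < l ] Q (g₁ i v) (g₂ i v)
    ≡⟨ ∑∑-cong select ⟨
  ∑[ i < m ] ∑[ v < l ] ∑[ u < n₁ ] ∑[ w < n₂ ] (hit i v u w * Q u w)
    ≡⟨ ∑∑-∑∑-comm (λ i v u w → hit i v u w * Q u w) ⟩
  ∑[ u < n₁ ] ∑[ w < n₂ ] ∑[ i < m ] ∑[ v < l ] (hit i v u w * Q u w)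
    ≡⟨ ∑∑-cong (λ u w → ∑∑-distribʳ-* (λ i v → hit i v u w) (Q u w)) ⟨
  ∑[ u < n₁ ] ∑[ w < n₂ ] ((∑[ i < m ] ∑[ v < l ] hit i v u w) * Q u w)
    ≤⟨ ∑∑-mono-≤ (λ u w → *-monoˡ-≤ (Q u w) (fiber≤1 u w)) ⟩
  ∑[ u < n₁ ] ∑[ w < n₂ ] (1 * Q u w)
    ≡⟨ ∑∑-cong (λ u w → *-identityˡ (Q u w)) ⟩
  ∑[ u < n₁ ] ∑[ w < n₂ ] Q u w ∎
  where
  open ≤-Reasoning
  hit : Fin m → Fin l → Fin n₁ → Fin n₂ → ℕ
  hit i v u w = 𝟙[ (g₁ i v ≟ u) ×-dec (g₂ i v ≟ w) ]

  select : ∀ i v → ∑[ u < n₁ ] ∑[ w < n₂ ] (hit i v u w * Q u w) ≡ Q (g₁ i v) (g₂ i v)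
  select i v = begin-equality
    ∑[ u < n₁ ] ∑[ w < n₂ ] (hit i v u w * Q u w)
      ≡⟨ ∑∑-cong (λ u w → trans (cong (_* Q u w) (𝟙-×-dec (g₁ i v ≟ u) (g₂ i v ≟ w)))
                                (*-assoc 𝟙[ g₁ i v ≟ u ] 𝟙[ g₂ i v ≟ w ] (Q u w))) ⟩
    ∑[ u < n₁ ] ∑[ w < n₂ ] (𝟙[ g₁ i v ≟ u ] * (𝟙[ g₂ i v ≟ w ] * Q u w))
      ≡⟨ sum-cong-≗ (λ u → *-distribˡ-sum 𝟙[ g₁ i v ≟ u ] (λ w → 𝟙[ g₂ i v ≟ w ] * Q u w)) ⟨
    ∑[ u < n₁ ] (𝟙[ g₁ i v ≟ u ] * ∑[ w < n₂ ] (𝟙[ g₂ i v ≟ w ] * Q u w))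
      ≡⟨ sum-cong-≗ (λ u → cong (𝟙[ g₁ i v ≟ u ] *_) (∑-𝟙-≟ (g₂ i v) (Q u))) ⟩
    ∑[ u < n₁ ] (𝟙[ g₁ i v ≟ u ] * Q u (g₂ i v))
      ≡⟨ ∑-𝟙-≟ (g₁ i v) (λ u → Q u (g₂ i v)) ⟩
    Q (g₁ i v) (g₂ i v) ∎

  fiber≤1 : ∀ u w → ∑[ i < m ] ∑[ v < l ] hit i v u w ≤ 1
  fiber≤1 u w = ∑∑-unique-≤1 (λ i v → hit i v u w)
    (λ i v → 𝟙≤1 ((g₁ i v ≟ u) ×-dec (g₂ i v ≟ w)))
    (λ i v j w′ hit>0 hit′>0 →
      let g₁≡u , g₂≡w = 𝟙>0⇒ ((g₁ i v ≟ u) ×-dec (g₂ i v ≟ w)) hit>0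
          g₁′≡u , g₂′≡w = 𝟙>0⇒ ((g₁ j w′ ≟ u) ×-dec (g₂ j w′ ≟ w)) hit′>0
      in injective i v j w′ (trans g₁≡u (sym g₁′≡u)) (trans g₂≡w (sym g₂′≡w)))

sum-map-tabulate : ∀ {A : Set} {n} (g : A → ℕ) (f : Fin n → A) →
                   List.sum (map g (tabulate f)) ≡ ∑[ i < n ] g (f i)
sum-map-tabulate {n = zero} g f = refl
sum-map-tabulate {n = suc n} g f = cong (g (f zero) +_) (sum-map-tabulate g (f ∘ suc))

sum-map-filter : ∀ {A : Set} {P : Pred A 0ℓ} (P? : Decidable P) (g : A → ℕ) xs →
                 List.sum (map g (filter P? xs)) ≡ List.sum (map (λ x → 𝟙[ P? x ] * g x) xs)
sum-map-filter P? g [] = refl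
sum-map-filter P? g (x ∷ xs) with P? x
... | yes _ = cong₂ _+_ (sym (+-identityʳ (g x))) (sum-map-filter P? g xs)
... | no _ = sum-map-filter P? g xs

sumFin≡∑ : ∀ {p} (g : Fin p → ℕ) → sumFin g ≡ ∑[ i < p ] g i
sumFin≡∑ g = sum-map-tabulate g (λ i → i)

sumPairs≡∑∑ : ∀ {p} (h : Fin p → Fin p → ℕ) →
              sumPairs h ≡ ∑[ i < p ] ∑[ j < p ] (𝟙[ toℕ i <? toℕ j ] * h i j)
sumPairs≡∑∑ {p} h = trans (sumFin≡∑ (λ i → List.sum (map (h i) (filter (λ j → toℕ i <? toℕ j) (allFin p)))))
  (sum-cong-≗ λ i →
  trans (sum-map-filter (λ j → toℕ i <? toℕ j) (h i) (tabulate (λ j → j)))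
        (sum-map-tabulate (λ j → 𝟙[ toℕ i <? toℕ j ] * h i j) (λ j → j)))

toℕ-next : ∀ {m} (v : Fin (suc m)) → toℕ (next v) ≡ suc (toℕ v) % suc m
toℕ-next {m} v = toℕ-fromℕ< (m%n<n (suc (toℕ v)) (suc m))

next≢ : ∀ {n} → 2 ≤ n → (v : Fin n) → next v ≢ v
next≢ {suc m} (s≤s 1≤m) v next≡v with m≤n⇒m<n∨m≡n (s≤s⁻¹ (toℕ<n v))
... | inj₁ v<m = 1+n≢n (trans (sym (m≤n⇒m%n≡m v<m)) (trans (sym (toℕ-next v)) (cong toℕ next≡v)))
... | inj₂ v≡m = <⇒≢ 1≤m (begin
  0                     ≡⟨ n%n≡0 (suc m) ⟨
  suc m % suc m         ≡⟨ cong (λ t → suc t % suc m) v≡m ⟨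
  suc (toℕ v) % suc m   ≡⟨ toℕ-next v ⟨
  toℕ (next v)          ≡⟨ cong toℕ next≡v ⟩
  toℕ v                 ≡⟨ v≡m ⟩
  m                     ∎)
  where open ≡-Reasoning

m*n≤o⇒n≤o/m : ∀ m {n o} .{{_ : NonZero m}} → m * n ≤ o → n ≤ o / m
m*n≤o⇒n≤o/m m {n} {o} mn≤o = begin
  n         ≡⟨ m*n/n≡m n m ⟨
  n * m / m ≤⟨ /-monoˡ-≤ m (subst (_≤ o) (*-comm m n) mn≤o) ⟩
  o / m     ∎
  where open ≤-Reasoning

coarsen : ∀ {n k p q} .{{_ : NonZero p}} → p ≤ q → LabeledPacking n k q → LabeledPacking n k p
coarsen {p = p} p≤q P = record
  { f = λ v → toℕ (f v) mod p
  ; f-onto = onto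
  ; σ = σ
  ; σ-inj = σ-inj
  ; arcs-disjoint = arcs-disjoint
  ; label-compat = λ i j v → cong (λ y → toℕ y mod p) (label-compat i j v)
  }
  where
  open LabeledPacking P
  onto : ∀ z → ∃ λ v → toℕ (f v) mod p ≡ z
  onto z with f-onto (inject≤ z p≤q)
  ... | v , fv≡z = v , toℕ-injective (begin
    toℕ (toℕ (f v) mod p) ≡⟨ toℕ-fromℕ< (m%n<n (toℕ (f v)) p) ⟩
    toℕ (f v) % p         ≡⟨ cong (λ y → toℕ y % p) fv≡z ⟩
    toℕ (inject≤ z p≤q) % p ≡⟨ cong (_% p) (toℕ-inject≤ z p≤q) ⟩
    toℕ z % p             ≡⟨ m<n⇒m%n≡m (toℕ<n z) ⟩
    toℕ z                 ∎)
    where open ≡-Reasoning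

module Counting {n k p} (P : LabeledPacking n k p) (copy₀ : Fin k) (2≤n : 2 ≤ n) where

  open LabeledPacking P

  -- by label-compat, every copy gives circuit vertex v this label
  label : Fin n → Fin p
  label v = f (σ copy₀ v)

  size : Fin p → ℕ
  size a = ∑[ u < n ] 𝟙[ f u ≟ a ]

  circuitArcs : Fin p → Fin p → ℕ
  circuitArcs a b = ∑[ v < n ] (𝟙[ label v ≟ a ] * 𝟙[ label (next v) ≟ b ])

  isClassArc : Fin p → Fin p → Fin n → Fin n → ℕ
  isClassArc a b u w = 𝟙[ ¬? (u ≟ w) ] * (𝟙[ f u ≟ a ] * 𝟙[ f w ≟ b ])

  classArcs : Fin p → Fin p → ℕ
  classArcs a b = ∑[ u < n ] ∑[ w < n ] isClassArc a b u w

  size-pos : ∀ a → 1 ≤ size a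
  size-pos a with f-onto a
  ... | v , fv≡a = subst (_≤ size a) (𝟙-yes (f v ≟ a) fv≡a) (≤-∑ (λ u → 𝟙[ f u ≟ a ]) v)

  ∑-size : ∑[ a < p ] size a ≡ n
  ∑-size = begin
    ∑[ a < p ] ∑[ u < n ] 𝟙[ f u ≟ a ]  ≡⟨ ∑-comm (λ a u → 𝟙[ f u ≟ a ]) ⟩
    ∑[ u < n ] ∑[ a < p ] 𝟙[ f u ≟ a ]  ≡⟨ sum-cong-≗ (λ u → ∑-𝟙 (f u)) ⟩
    ∑[ u < n ] 1                        ≡⟨ ∑-const n 1 ⟩
    n * 1                               ≡⟨ *-identityʳ n ⟩
    n                                   ∎
    where open ≡-Reasoning

  ∑∑-circuitArcs : ∑[ a < p ] ∑[ b < p ] circuitArcs a b ≡ n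
  ∑∑-circuitArcs = begin
    ∑[ a < p ] ∑[ b < p ] ∑[ v < n ] arc a b v
      ≡⟨ sum-cong-≗ (λ a → ∑-comm (λ b v → arc a b v)) ⟩
    ∑[ a < p ] ∑[ v < n ] ∑[ b < p ] arc a b v
      ≡⟨ ∑-comm (λ a v → ∑[ b < p ] arc a b v) ⟩
    ∑[ v < n ] ∑[ a < p ] ∑[ b < p ] arc a b v
      ≡⟨ ∑∑-cong (λ v a → *-distribˡ-sum 𝟙[ label v ≟ a ] (λ b → 𝟙[ label (next v) ≟ b ])) ⟨
    ∑[ v < n ] ∑[ a < p ] (𝟙[ label v ≟ a ] * ∑[ b < p ] 𝟙[ label (next v) ≟ b ])
      ≡⟨ ∑∑-cong (λ v a → cong (𝟙[ label v ≟ a ] *_) (∑-𝟙 (label (next v)))) ⟩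
    ∑[ v < n ] ∑[ a < p ] (𝟙[ label v ≟ a ] * 1)
      ≡⟨ sum-cong-≗ (λ v → ∑-𝟙-≟ (label v) (λ _ → 1)) ⟩
    ∑[ v < n ] 1
      ≡⟨ trans (∑-const n 1) (*-identityʳ n) ⟩
    n ∎
    where
    open ≡-Reasoning
    arc : Fin p → Fin p → Fin n → ℕ
    arc a b v = 𝟙[ label v ≟ a ] * 𝟙[ label (next v) ≟ b ]

  classArcs+loops : ∀ a b → classArcs a b + ∑[ u < n ] (𝟙[ f u ≟ a ] * 𝟙[ f u ≟ b ]) ≡ size a * size b
  classArcs+loops a b = begin
    classArcs a b + ∑[ u < n ] X u u
      ≡⟨ +-comm (classArcs a b) _ ⟩
    ∑[ u < n ] X u u + classArcs a b
      ≡⟨ ∑∑-diagonal X ⟨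
    ∑[ u < n ] ∑[ w < n ] X u w
      ≡⟨ sum-cong-≗ (λ u → *-distribˡ-sum 𝟙[ f u ≟ a ] (λ w → 𝟙[ f w ≟ b ])) ⟨
    ∑[ u < n ] (𝟙[ f u ≟ a ] * size b)
      ≡⟨ *-distribʳ-sum (size b) (λ u → 𝟙[ f u ≟ a ]) ⟨
    size a * size b ∎
    where
    open ≡-Reasoning
    X : Fin n → Fin n → ℕ
    X u w = 𝟙[ f u ≟ a ] * 𝟙[ f w ≟ b ]

  classArcs≤ : ∀ a b → classArcs a b ≤ size a * size b
  classArcs≤ a b = subst (classArcs a b ≤_) (classArcs+loops a b) (m≤m+n _ _)

  classArcs-loop : ∀ a → classArcs a a ≡ size a * (size a ∸ 1)
  classArcs-loop a = begin
    classArcs a a                    ≡⟨ m+n∸n≡m (classArcs a a) (size a) ⟨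
    classArcs a a + size a ∸ size a  ≡⟨ cong (λ s → classArcs a a + s ∸ size a) loops≡size ⟨
    classArcs a a + ∑[ u < n ] (𝟙[ f u ≟ a ] * 𝟙[ f u ≟ a ]) ∸ size a
                                     ≡⟨ cong (_∸ size a) (classArcs+loops a a) ⟩
    size a * size a ∸ size a         ≡⟨ cong (size a * size a ∸_) (*-identityʳ (size a)) ⟨
    size a * size a ∸ size a * 1     ≡⟨ *-distribˡ-∸ (size a) (size a) 1 ⟨
    size a * (size a ∸ 1)            ∎
    where
    open ≡-Reasoning
    loops≡size : ∑[ u < n ] (𝟙[ f u ≟ a ] * 𝟙[ f u ≟ a ]) ≡ size a
    loops≡size = sum-cong-≗ (λ u → 𝟙-idem (f u ≟ a))

  σ-next≢ : ∀ i v → σ i v ≢ σ i (next v)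
  σ-next≢ i v σv≡σnext = next≢ 2≤n v (sym (σ-inj i v (next v) σv≡σnext))

  isClassArc-image : ∀ a b i v →
    isClassArc a b (σ i v) (σ i (next v)) ≡ 𝟙[ label v ≟ a ] * 𝟙[ label (next v) ≟ b ]
  isClassArc-image a b i v = begin
    𝟙[ ¬? (σ i v ≟ σ i (next v)) ] * (𝟙[ f (σ i v) ≟ a ] * 𝟙[ f (σ i (next v)) ≟ b ])
      ≡⟨ cong (_* (𝟙[ f (σ i v) ≟ a ] * 𝟙[ f (σ i (next v)) ≟ b ]))
              (𝟙-yes (¬? (σ i v ≟ σ i (next v))) (σ-next≢ i v)) ⟩
    1 * (𝟙[ f (σ i v) ≟ a ] * 𝟙[ f (σ i (next v)) ≟ b ])
      ≡⟨ *-identityˡ _ ⟩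
    𝟙[ f (σ i v) ≟ a ] * 𝟙[ f (σ i (next v)) ≟ b ]
      ≡⟨ cong₂ (λ x y → 𝟙[ x ≟ a ] * 𝟙[ y ≟ b ]) (label-compat i copy₀ v) (label-compat i copy₀ (next v)) ⟩
    𝟙[ label v ≟ a ] * 𝟙[ label (next v) ≟ b ] ∎
    where open ≡-Reasoning

  arc-images-injective : ∀ i v j w → σ i v ≡ σ j w → σ i (next v) ≡ σ j (next w) → (i , v) ≡ (j , w)
  arc-images-injective i v j w tail≡ head≡ with i ≟ j
  ... | yes refl = cong (i ,_) (σ-inj i v w tail≡)
  ... | no i≢j = contradiction (tail≡ , head≡) (arcs-disjoint i j i≢j v w)

  k*circuitArcs≤classArcs : ∀ a b → k * circuitArcs a b ≤ classArcs a b
  k*circuitArcs≤classArcs a b = begin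
    k * circuitArcs a b
      ≡⟨ ∑-const k (circuitArcs a b) ⟨
    ∑[ i < k ] circuitArcs a b
      ≡⟨ ∑∑-cong (isClassArc-image a b) ⟨
    ∑[ i < k ] ∑[ v < n ] isClassArc a b (σ i v) (σ i (next v))
      ≤⟨ ∑∑-injective-≤ σ (λ i v → σ i (next v)) arc-images-injective (isClassArc a b) ⟩
    classArcs a b ∎
    where open ≤-Reasoning

  module _ .{{_ : NonZero k}} where

    circuitArcs-loop-≤ : ∀ a → circuitArcs a a ≤ size a * (size a ∸ 1) / k
    circuitArcs-loop-≤ a = m*n≤o⇒n≤o/m k
      (subst (k * circuitArcs a a ≤_) (classArcs-loop a) (k*circuitArcs≤classArcs a a))

    circuitArcs-pair-≤ : ∀ a b → circuitArcs a b + circuitArcs b a ≤ 2 * size a * size b / k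
    circuitArcs-pair-≤ a b = m*n≤o⇒n≤o/m k (begin
      k * (circuitArcs a b + circuitArcs b a)
        ≡⟨ *-distribˡ-+ k (circuitArcs a b) (circuitArcs b a) ⟩
      k * circuitArcs a b + k * circuitArcs b a
        ≤⟨ +-mono-≤ (k*circuitArcs≤classArcs a b) (k*circuitArcs≤classArcs b a) ⟩
      classArcs a b + classArcs b a
        ≤⟨ +-mono-≤ (classArcs≤ a b) (classArcs≤ b a) ⟩
      size a * size b + size b * size a
        ≡⟨ twice (size a) (size b) ⟩
      2 * size a * size b ∎)
      where
      open ≤-Reasoning
      twice : ∀ x y → x * y + y * x ≡ 2 * x * y
      twice = solve-∀

    n≤∑∑-bounds : n ≤ ∑[ a < p ] (size a * (size a ∸ 1) / k) +
                      ∑[ a < p ] ∑[ b < p ] (𝟙[ toℕ a <? toℕ b ] * (2 * size a * size b / k))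
    n≤∑∑-bounds = begin
      n
        ≡⟨ ∑∑-circuitArcs ⟨
      ∑[ a < p ] ∑[ b < p ] circuitArcs a b
        ≡⟨ ∑∑-upper circuitArcs ⟩
      ∑[ a < p ] circuitArcs a a +
        ∑[ a < p ] ∑[ b < p ] (𝟙[ toℕ a <? toℕ b ] * (circuitArcs a b + circuitArcs b a))
        ≤⟨ +-mono-≤ (∑-mono-≤ circuitArcs-loop-≤)
                    (∑∑-mono-≤ (λ a b → *-monoʳ-≤ 𝟙[ toℕ a <? toℕ b ] (circuitArcs-pair-≤ a b))) ⟩
      ∑[ a < p ] (size a * (size a ∸ 1) / k) +
        ∑[ a < p ] ∑[ b < p ] (𝟙[ toℕ a <? toℕ b ] * (2 * size a * size b / k)) ∎
      where open ≤-Reasoning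

mainTheorem14 : (k x p : ℕ) → 2 ≤ k → 1 ≤ x →
    ¬ ((x , k + x) ≡ (1 , 4)) → ¬ ((x , k + x) ≡ (1 , 6)) →
    1 ≤ p → LeLambda p k (k + x) →
    Σ (Fin p → ℕ) λ ns →
      (∀ i → 1 ≤ ns i) ×
      (sumFin ns ≡ k + x) ×
      (sumFin (λ i → fdiv (ns i * (ns i ∸ 1)) k)
        + sumPairs (λ i j → fdiv (2 * ns i * ns j) k) ≥ k + x)
mainTheorem14 k x p (s≤s (s≤s z≤n)) _ _ _ (s≤s z≤n) (q , p≤q , P) =
  size , size-pos , trans (sumFin≡∑ size) ∑-size ,
  subst (k + x ≤_)
        (sym (cong₂ _+_ (sumFin≡∑ (λ a → size a * (size a ∸ 1) / k))
                        (sumPairs≡∑∑ (λ a b → 2 * size a * size b / k))))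
        n≤∑∑-bounds
  where open Counting (coarsen p≤q P) zero (s≤s (s≤s z≤n))
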